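{- The free positive S4-algebra on one generator $x$ is isomorphic to the following finite algebra $\mathbf{A}$, with free generator corresponding to $g_x$. The bounded lattice reduct of $\mathbf{A}$ is the bounded distributive lattice presented by seven generators $g_x,g_{\Box x},g_{\Diamond x},g_{\Diamond\Box x},g_{\Box\Diamond x},g_{\Box\Diamond\Box x},g_{\Diamond\Box\Diamond x}$ subject exactly to the relations $g_{\Box x}\le g_x\le g_{\Diamond x}$, $g_{\Box x}\le g_{\Box\Diamond\Box x}\le g_{\Box\Diamond x}\le g_{\Diamond\Box\Diamond x}\le g_{\Diamond x}$ and $g_{\Box\Diamond\Box x}\le g_{\Diamond\Box x}\le g_{\Diamond\Box\Diamond x}$ (i.e. the quotient of the free bounded distributive lattice on these seven generators by the lattice congruence generated by these inequalities); for every $c\in A$, $\Box c$ is the largest element of the chain $0\le g_{\Box x}\le g_{\Box\Diamond\Box x}\le g_{\Box\Diamond x}\le 1$ lying below $c$, and $\Diamond c$ is the smallest element of the chain $0\le g_{\Diamond\Box x}\le g_{\Diamond\Box\Diamond x}\le g_{\Diamond x}\le 1$ lying above $c$.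
   Context: A positive S4-algebra is a structure $\langle A,\land,\lor,\Box,\Diamond,0,1\rangle$ such that $\langle A,\land,\lor,0,1\rangle$ is a bounded distributive lattice, $\Box 1=1$, $\Diamond 0=0$, and for all $a,b$: $\Box(a\land b)=\Box a\land\Box b$, $\Diamond(a\lor b)=\Diamond a\lor\Diamond b$, $\Box a\land\Diamond b\le\Diamond(a\land b)$, $\Box(a\lor b)\le\Box a\lor\Diamond b$, and $\Box\Box a=\Box a\le a\le\Diamond a=\Diamond\Diamond a$. -}

module Defs where

open import Level using (Level; _⊔_; suc) renaming (zero to 0ℓ)
open import Algebra.Core using (Op₁; Op₂)
open import Algebra.Lattice.Structures using (IsDistributiveLattice)
open import Relation.Binary.Core using (Rel)
open import Data.Product using (Σ; Σ-syntax; _×_; ∃; ∃-syntax)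
open import Data.Sum using (_⊎_)

module _ {a ℓ} {A : Set a} (_≈_ : Rel A ℓ) (_∧_ : Op₂ A) where
  LatLe : A → A → Set ℓ
  LatLe x y = (x ∧ y) ≈ x

record IsPositiveS4 {a ℓ} {A : Set a} (_≈_ : Rel A ℓ)
                    (_∧_ _∨_ : Op₂ A) (□ ◇ : Op₁ A) (0# 1# : A) : Set (a ⊔ ℓ) where
  _≤_ : A → A → Set ℓ
  _≤_ = LatLe _≈_ _∧_
  field
    isDistributiveLattice : IsDistributiveLattice _≈_ _∨_ _∧_
    ∨-identityʳ : ∀ x → (x ∨ 0#) ≈ x
    ∧-identityʳ : ∀ x → (x ∧ 1#) ≈ x
    □-cong : ∀ {x y} → x ≈ y → □ x ≈ □ y
    ◇-cong : ∀ {x y} → x ≈ y → ◇ x ≈ ◇ y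
    □-1 : □ 1# ≈ 1#
    ◇-0 : ◇ 0# ≈ 0#
    □-∧ : ∀ x y → □ (x ∧ y) ≈ (□ x ∧ □ y)
    ◇-∨ : ∀ x y → ◇ (x ∨ y) ≈ (◇ x ∨ ◇ y)
    □∧◇≤◇∧ : ∀ x y → (□ x ∧ ◇ y) ≤ ◇ (x ∧ y)
    □∨≤□∨◇ : ∀ x y → □ (x ∨ y) ≤ (□ x ∨ ◇ y)
    □□ : ∀ x → □ (□ x) ≈ □ x
    □≤ : ∀ x → □ x ≤ x
    ≤◇ : ∀ x → x ≤ ◇ x
    ◇◇ : ∀ x → ◇ (◇ x) ≈ ◇ x

record PositiveS4 (c ℓ : Level) : Set (suc (c ⊔ ℓ)) where
  field
    Carrier : Set c
    _≈_ : Rel Carrier ℓ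
    _∧_ _∨_ : Op₂ Carrier
    □ ◇ : Op₁ Carrier
    0# 1# : Carrier
    isPositiveS4 : IsPositiveS4 _≈_ _∧_ _∨_ □ ◇ 0# 1#
  open IsPositiveS4 isPositiveS4 public

record IsHom {c₁ ℓ₁ c₂ ℓ₂} (A : PositiveS4 c₁ ℓ₁) (B : PositiveS4 c₂ ℓ₂)
             (f : PositiveS4.Carrier A → PositiveS4.Carrier B) : Set (c₁ ⊔ ℓ₁ ⊔ ℓ₂) where
  private
    module A = PositiveS4 A
    module B = PositiveS4 B
  field
    cong : ∀ {x y} → x A.≈ y → f x B.≈ f y
    hom-∧ : ∀ x y → f (x A.∧ y) B.≈ (f x B.∧ f y)
    hom-∨ : ∀ x y → f (x A.∨ y) B.≈ (f x B.∨ f y)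
    hom-□ : ∀ x → f (A.□ x) B.≈ B.□ (f x)
    hom-◇ : ∀ x → f (A.◇ x) B.≈ B.◇ (f x)
    hom-0 : f A.0# B.≈ B.0#
    hom-1 : f A.1# B.≈ B.1#

IsFreeOn : ∀ {c₁ ℓ₁} (A : PositiveS4 c₁ ℓ₁) (g : PositiveS4.Carrier A)
           (c ℓ : Level) → Set (c₁ ⊔ ℓ₁ ⊔ suc (c ⊔ ℓ))
IsFreeOn A g c ℓ =
  (B : PositiveS4 c ℓ) (b : PositiveS4.Carrier B) →
  Σ[ f ∈ (PositiveS4.Carrier A → PositiveS4.Carrier B) ]
    (IsHom A B f × PositiveS4._≈_ B (f g) b ×
     ((f′ : PositiveS4.Carrier A → PositiveS4.Carrier B) → IsHom A B f′ →
      PositiveS4._≈_ B (f′ g) b →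
      ∀ x → PositiveS4._≈_ B (f x) (f′ x)))

data Gen : Set where
  x □x ◇x ◇□x □◇x □◇□x ◇□◇x : Gen

data GenRel : Gen → Gen → Set where
  □x≤x      : GenRel □x x
  x≤◇x      : GenRel x ◇x
  □x≤□◇□x   : GenRel □x □◇□x
  □◇□x≤□◇x  : GenRel □◇□x □◇x
  □◇x≤◇□◇x  : GenRel □◇x ◇□◇x
  ◇□◇x≤◇x   : GenRel ◇□◇x ◇x
  □◇□x≤◇□x  : GenRel □◇□x ◇□x
  ◇□x≤◇□◇x  : GenRel ◇□x ◇□◇x

data Tm : Set where
  gen : Gen → Tm
  ⊥ₜ ⊤ₜ : Tm
  _∧ₜ_ _∨ₜ_ : Tm → Tm → Tm

infixr 7 _∧ₜ_
infixr 6 _∨ₜ_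
infix 4 _≈ₜ_

-- the least congruence on terms containing the bounded distributive
-- lattice axioms and the defining relations (p ≤ q read as p ∧ q = p);
-- Tm / ≈ₜ is the presented bounded distributive lattice
data _≈ₜ_ : Tm → Tm → Set where
  refl  : ∀ {s} → s ≈ₜ s
  sym   : ∀ {s t} → s ≈ₜ t → t ≈ₜ s
  trans : ∀ {s t u} → s ≈ₜ t → t ≈ₜ u → s ≈ₜ u
  ∧-cong : ∀ {s s′ t t′} → s ≈ₜ s′ → t ≈ₜ t′ → s ∧ₜ t ≈ₜ s′ ∧ₜ t′
  ∨-cong : ∀ {s s′ t t′} → s ≈ₜ s′ → t ≈ₜ t′ → s ∨ₜ t ≈ₜ s′ ∨ₜ t′
  ∧-comm  : ∀ s t → s ∧ₜ t ≈ₜ t ∧ₜ s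
  ∨-comm  : ∀ s t → s ∨ₜ t ≈ₜ t ∨ₜ s
  ∧-assoc : ∀ s t u → (s ∧ₜ t) ∧ₜ u ≈ₜ s ∧ₜ (t ∧ₜ u)
  ∨-assoc : ∀ s t u → (s ∨ₜ t) ∨ₜ u ≈ₜ s ∨ₜ (t ∨ₜ u)
  ∧-absorbs-∨ : ∀ s t → s ∧ₜ (s ∨ₜ t) ≈ₜ s
  ∨-absorbs-∧ : ∀ s t → s ∨ₜ (s ∧ₜ t) ≈ₜ s
  ∧-distrib-∨ : ∀ s t u → s ∧ₜ (t ∨ₜ u) ≈ₜ (s ∧ₜ t) ∨ₜ (s ∧ₜ u)
  ∧-identity : ∀ s → s ∧ₜ ⊤ₜ ≈ₜ s
  ∨-identity : ∀ s → s ∨ₜ ⊥ₜ ≈ₜ s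
  rel : ∀ {p q} → GenRel p q → gen p ∧ₜ gen q ≈ₜ gen p

_≤ₜ_ : Tm → Tm → Set
s ≤ₜ t = s ∧ₜ t ≈ₜ s

data BoxChain : Tm → Set where
  b0 : BoxChain ⊥ₜ
  b1 : BoxChain (gen □x)
  b2 : BoxChain (gen □◇□x)
  b3 : BoxChain (gen □◇x)
  b4 : BoxChain ⊤ₜ

data DiaChain : Tm → Set where
  d0 : DiaChain ⊥ₜ
  d1 : DiaChain (gen ◇□x)
  d2 : DiaChain (gen ◇□◇x)
  d3 : DiaChain (gen ◇x)
  d4 : DiaChain ⊤ₜ

IsLargestBelow : (Tm → Set) → Tm → Tm → Set
IsLargestBelow C c m =
  (Σ[ d ∈ Tm ] (C d × m ≈ₜ d)) × m ≤ₜ c × (∀ d → C d → d ≤ₜ c → d ≤ₜ m)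

IsSmallestAbove : (Tm → Set) → Tm → Tm → Set
IsSmallestAbove C c m =
  (Σ[ d ∈ Tm ] (C d × m ≈ₜ d)) × c ≤ₜ m × (∀ d → C d → c ≤ₜ d → m ≤ₜ d)

𝐀 : (□ₜ ◇ₜ : Tm → Tm) → IsPositiveS4 _≈ₜ_ _∧ₜ_ _∨ₜ_ □ₜ ◇ₜ ⊥ₜ ⊤ₜ → PositiveS4 0ℓ 0ℓ
𝐀 □ₜ ◇ₜ isS4 = record
  { Carrier = Tm ; _≈_ = _≈ₜ_ ; _∧_ = _∧ₜ_ ; _∨_ = _∨ₜ_
  ; □ = □ₜ ; ◇ = ◇ₜ ; 0# = ⊥ₜ ; 1# = ⊤ₜ ; isPositiveS4 = isS4 }

-- The presented lattice L = Tm/≈ₜ is finite: its prime filters are the fourteen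
-- up-sets of the generator poset, every term is the join of the minterms of the
-- up-sets satisfying it and the meet of the maxterms of those that do not, so the
-- order of L is decided by evaluation at these fourteen worlds. □ₜ and ◇ₜ are the
-- box and diamond of the relation R that relates w to u when every box-chain element
-- true at w is true at u and every diamond-chain element true at u is true at w;
-- hence they satisfy the positive S4 axioms. For freeness, send the generators to
-- b, □b, ◇b, ◇□b, □◇b, □◇□b, ◇□◇b; the defining inequalities hold in every positive
-- S4-algebra, so this extends to a lattice homomorphism. It commutes with □ because
-- □ preserves meets and every maxterm J satisfies J ≤ y and z ≤ J for a pair (y, z)
-- with z on the box chain and □y ≤ z in every positive S4-algebra, the essential one
-- being □(a ∨ ◇□a) ≤ □◇□a; dually for ◇, with minterms and ◇□◇a ≤ ◇(a ∧ □◇a).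

module Submission where

open import Defs using (LatLe; PositiveS4)
open import Level using (Level) renaming (zero to 0ℓ)
open import Function.Base using (id; flip; _∘_)
open import Function.Bundles using (_⇔_; mk⇔; Equivalence)
open Equivalence using (to; from)
import Function.Properties.Equivalence as ⇔
open import Data.Bool using (Bool; true; false; T; if_then_else_)
open import Data.Fin using (Fin; #_)
open import Data.Fin.Properties using (all?; any?)
open import Data.Empty using (⊥)
open import Data.Unit using (⊤; tt)
open import Data.Product as Product using (Σ-syntax; _×_; _,_; proj₁; proj₂; ∃; ∃-syntax)
open import Data.Sum as Sum using (_⊎_; inj₁; inj₂; [_,_])
open import Data.List using (List; []; _∷_; foldr; map; filter; allFin)
open import Data.Bool.ListAction using (any)
open import Data.List.Membership.Propositional using (_∈_; find)
open import Data.List.Membership.Propositional.Properties using (∈-allFin; ∈-map∘filter⁺; ∈-map∘filter⁻)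
open import Data.List.Relation.Unary.All as All using (All; []; _∷_)
import Data.List.Relation.Unary.All.Properties as All
open import Data.List.Relation.Unary.Any as Any using (Any; here; there)
open import Data.List.Relation.Unary.AllPairs using (AllPairs; []; _∷_; allPairs?)
open import Data.Vec using (Vec; []; _∷_; lookup)
open import Relation.Binary.Bundles using (Setoid)
open import Relation.Binary.Core using (Rel)
open import Relation.Binary.Definitions using (Reflexive)
open import Relation.Binary.PropositionalEquality as ≡ using (_≡_)
open import Relation.Binary.Construct.Closure.ReflexiveTransitive as Star using (Star; ε; _◅_)
open import Relation.Nullary using (Dec; yes; no; does; ¬_; contradiction)
open import Relation.Nullary.Decidable using (T?; ¬?; map′; _×-dec_; _⊎-dec_; _→-dec_; from-yes; decidable-stable)
open import Relation.Unary using (Pred; Decidable)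
open import Algebra.Core using (Op₂)
open import Algebra.Lattice.Bundles using (Lattice)
open import Algebra.Lattice.Structures using (IsDistributiveLattice)
import Algebra.Consequences.Setoid as Consequences
import Algebra.Lattice.Properties.Lattice as LatticeProperties
import Relation.Binary.Lattice as Order
import Relation.Binary.Lattice.Properties.JoinSemilattice as JoinSemilatticeProperties
import Relation.Binary.Lattice.Properties.MeetSemilattice as MeetSemilatticeProperties
import Relation.Binary.Reasoning.PartialOrder as ≤-Reasoning

module _ {a p} {A : Set a} {P : Pred A p} (P? : Decidable P) (default : A) where

  first : List A → A
  first []       = default
  first (d ∷ ds) = if does (P? d) then d else first ds

  first-satisfies : P default → ∀ ds → P (first ds)
  first-satisfies p[default] []       = p[default]
  first-satisfies p[default] (d ∷ ds) with P? d
  ... | yes pd = pd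
  ... | no  _  = first-satisfies p[default] ds

  first-All : ∀ {q} {Q : Pred A q} {ds} → Q default → All Q ds → Q (first ds)
  first-All q[default] []                        = q[default]
  first-All {ds = d ∷ _} q[default] (qd ∷ qds) with P? d
  ... | yes _ = qd
  ... | no  _ = first-All q[default] qds

  first-greatest : ∀ {r} {_⊒_ : Rel A r} → Reflexive _⊒_ →
                   ∀ {d ds} → AllPairs _⊒_ ds → d ∈ ds → P d → first ds ⊒ d
  first-greatest ⊒-refl {ds = e ∷ _} (e⊒es ∷ sorted) d∈ds pd with P? e | d∈ds
  ... | yes _  | here ≡.refl  = ⊒-refl
  ... | yes _  | there d∈es   = All.lookup e⊒es d∈es
  ... | no ¬pe | here ≡.refl  = contradiction pd ¬pe
  ... | no _   | there d∈es   = first-greatest ⊒-refl sorted d∈es pd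

module BoundedDistributiveLatticeOrder {a ℓ} {A : Set a} {_≈_ : Rel A ℓ} {_∨_ _∧_ : Op₂ A}
  (isDistributiveLattice : IsDistributiveLattice _≈_ _∨_ _∧_) {⊥ ⊤ : A}
  (∨-identityʳ : ∀ x → (x ∨ ⊥) ≈ x) (∧-identityʳ : ∀ x → (x ∧ ⊤) ≈ x) where

  open IsDistributiveLattice isDistributiveLattice

  private
    lattice : Lattice a ℓ
    lattice = record { isLattice = isLattice }

    module N = Order.Lattice (LatticeProperties.∨-∧-orderTheoreticLattice lattice)

  -- N._≤_ is the standard library's natural order x ≈ x ∧ y; LatLe flips the equation.
  ≤-isLattice : Order.IsLattice _≈_ (LatLe _≈_ _∧_) _∨_ _∧_
  ≤-isLattice = record
    { isPartialOrder = record
      { isPreorder = record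
        { isEquivalence = isEquivalence
        ; reflexive     = λ x≈y → sym (N.reflexive x≈y)
        ; trans         = λ x≤y y≤z → sym (N.trans (sym x≤y) (sym y≤z))
        }
      ; antisym = λ x≤y y≤x → N.antisym (sym x≤y) (sym y≤x)
      }
    ; supremum = λ x y → sym (N.x≤x∨y x y) , sym (N.y≤x∨y x y) ,
                         λ z x≤z y≤z → sym (N.∨-least (sym x≤z) (sym y≤z))
    ; infimum  = λ x y → sym (N.x∧y≤x x y) , sym (N.x∧y≤y x y) ,
                         λ z z≤x z≤y → sym (N.∧-greatest (sym z≤x) (sym z≤y))
    }

  ≤-lattice : Order.Lattice a ℓ ℓ
  ≤-lattice = record { isLattice = ≤-isLattice }

  open Order.Lattice ≤-lattice public
    using (_≤_; poset; x∧y≤x; x∧y≤y; ∧-greatest; x≤x∨y; y≤x∨y; ∨-least)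
    renaming (refl to ≤-refl; reflexive to ≤-reflexive; trans to ≤-trans; antisym to ≤-antisym)
  open JoinSemilatticeProperties (Order.Lattice.joinSemilattice ≤-lattice) public
    using (∨-monotonic)
  open MeetSemilatticeProperties (Order.Lattice.meetSemilattice ≤-lattice) public
    using (∧-monotonic)
  open ≤-Reasoning poset

  ⊥-minimum : ∀ x → ⊥ ≤ x
  ⊥-minimum x = ≤-trans (y≤x∨y x ⊥) (≤-reflexive (∨-identityʳ x))

  ⊤-maximum : ∀ x → x ≤ ⊤
  ⊤-maximum = ∧-identityʳ

  ⋁ ⋀ : List A → A
  ⋁ = foldr _∨_ ⊥
  ⋀ = foldr _∧_ ⊤

  ⋁-upper : ∀ {x xs} → x ∈ xs → x ≤ ⋁ xs
  ⋁-upper (here ≡.refl) = x≤x∨y _ _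
  ⋁-upper (there x∈xs)  = ≤-trans (⋁-upper x∈xs) (y≤x∨y _ _)

  ⋁-least : ∀ {y xs} → All (_≤ y) xs → ⋁ xs ≤ y
  ⋁-least []           = ⊥-minimum _
  ⋁-least (x≤y ∷ xs≤y) = ∨-least x≤y (⋁-least xs≤y)

  ⋀-lower : ∀ {x xs} → x ∈ xs → ⋀ xs ≤ x
  ⋀-lower (here ≡.refl) = x∧y≤x _ _
  ⋀-lower (there x∈xs)  = ≤-trans (x∧y≤y _ _) (⋀-lower x∈xs)

  ⋀-greatest : ∀ {y xs} → All (y ≤_) xs → y ≤ ⋀ xs
  ⋀-greatest []           = ⊤-maximum _
  ⋀-greatest (y≤x ∷ y≤xs) = ∧-greatest y≤x (⋀-greatest y≤xs)

  ∧-⋁-least : ∀ {x z} ys → (∀ {y} → y ∈ ys → (x ∧ y) ≤ z) → (x ∧ ⋁ ys) ≤ z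
  ∧-⋁-least {x} {z} []       _  = ≤-trans (x∧y≤y x ⊥) (⊥-minimum z)
  ∧-⋁-least {x} {z} (y ∷ ys) le = begin
    x ∧ (y ∨ ⋁ ys)         ≈⟨ ∧-distribˡ-∨ x y (⋁ ys) ⟩
    (x ∧ y) ∨ (x ∧ ⋁ ys)   ≤⟨ ∨-least (le (here ≡.refl)) (∧-⋁-least ys (le ∘ there)) ⟩
    z                      ∎

  ⋁-∧-⋁-least : ∀ {z} xs ys → (∀ {x y} → x ∈ xs → y ∈ ys → (x ∧ y) ≤ z) → (⋁ xs ∧ ⋁ ys) ≤ z
  ⋁-∧-⋁-least {z} xs ys le = begin
    ⋁ xs ∧ ⋁ ys  ≈⟨ ∧-comm (⋁ xs) (⋁ ys) ⟩
    ⋁ ys ∧ ⋁ xs  ≤⟨ ∧-⋁-least xs (λ {x} x∈xs → begin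
                      ⋁ ys ∧ x  ≈⟨ ∧-comm (⋁ ys) x ⟩
                      x ∧ ⋁ ys  ≤⟨ ∧-⋁-least ys (le x∈xs) ⟩
                      z         ∎) ⟩
    z            ∎

module PositiveS4Properties {c ℓ} (A : PositiveS4 c ℓ) where
  open PositiveS4 A hiding (_≤_)

  open IsDistributiveLattice isDistributiveLattice using (sym; trans; ∧-comm)
  open BoundedDistributiveLatticeOrder isDistributiveLattice ∨-identityʳ ∧-identityʳ public
  open JoinSemilatticeProperties (Order.Lattice.joinSemilattice ≤-lattice) using (x≤y⇒x∨y≈y)
  open ≤-Reasoning poset

  □-mono : ∀ {x y} → x ≤ y → □ x ≤ □ y
  □-mono {x} {y} x≤y = trans (sym (□-∧ x y)) (□-cong x≤y)

  ◇-mono : ∀ {x y} → x ≤ y → ◇ x ≤ ◇ y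
  ◇-mono {x} {y} x≤y = begin
    ◇ x        ≤⟨ x≤x∨y (◇ x) (◇ y) ⟩
    ◇ x ∨ ◇ y  ≈⟨ ◇-∨ x y ⟨
    ◇ (x ∨ y)  ≈⟨ ◇-cong (x≤y⇒x∨y≈y x≤y) ⟩
    ◇ y        ∎

  □≤□□ : ∀ x → □ x ≤ □ (□ x)
  □≤□□ x = ≤-reflexive (sym (□□ x))

  ◇◇≤◇ : ∀ x → ◇ (◇ x) ≤ ◇ x
  ◇◇≤◇ x = ≤-reflexive (◇◇ x)

  □[x∨◇□x]≤□◇□x : ∀ x → □ (x ∨ ◇ (□ x)) ≤ □ (◇ (□ x))
  □[x∨◇□x]≤□◇□x x = begin
    □ (x ∨ ◇ (□ x))        ≤⟨ □≤□□ _ ⟩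
    □ (□ (x ∨ ◇ (□ x)))    ≤⟨ □-mono (□∨≤□∨◇ x (◇ (□ x))) ⟩
    □ (□ x ∨ ◇ (◇ (□ x)))  ≤⟨ □-mono (∨-least (≤◇ (□ x)) (◇◇≤◇ (□ x))) ⟩
    □ (◇ (□ x))            ∎

  ◇□◇x≤◇[x∧□◇x] : ∀ x → ◇ (□ (◇ x)) ≤ ◇ (x ∧ □ (◇ x))
  ◇□◇x≤◇[x∧□◇x] x = begin
    ◇ (□ (◇ x))            ≤⟨ ◇-mono (∧-greatest (□≤□□ (◇ x)) (□≤ (◇ x))) ⟩
    ◇ (□ (□ (◇ x)) ∧ ◇ x)  ≤⟨ ◇-mono (□∧◇≤◇∧ (□ (◇ x)) x) ⟩
    ◇ (◇ (□ (◇ x) ∧ x))    ≤⟨ ◇◇≤◇ _ ⟩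
    ◇ (□ (◇ x) ∧ x)        ≈⟨ ◇-cong (∧-comm _ _) ⟩
    ◇ (x ∧ □ (◇ x))        ∎

-- Opened in full only here: the constructors of _≈ₜ_ (refl, sym, ∧-comm, …) clash with the
-- lattice fields used above.
open Defs

-- The presented lattice and its prime filters

≈ₜ-setoid : Setoid 0ℓ 0ℓ
≈ₜ-setoid = record
  { Carrier = Tm ; _≈_ = _≈ₜ_ ; isEquivalence = record { refl = refl ; sym = sym ; trans = trans } }

open Consequences ≈ₜ-setoid using (comm∧distrˡ⇒distr; distrib∧absorbs⇒distribˡ)
open import Algebra.Definitions _≈ₜ_ using (_DistributesOver_)

∧ₜ-distrib-∨ₜ : _∧ₜ_ DistributesOver _∨ₜ_
∧ₜ-distrib-∨ₜ = comm∧distrˡ⇒distr ∨-cong ∧-comm ∧-distrib-∨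

∨ₜ-distrib-∧ₜ : _∨ₜ_ DistributesOver _∧ₜ_
∨ₜ-distrib-∧ₜ = comm∧distrˡ⇒distr ∧-cong ∨-comm
  (distrib∧absorbs⇒distribˡ ∨-cong ∨-assoc ∧-comm ∨-absorbs-∧ ∧-absorbs-∨ ∧ₜ-distrib-∨ₜ)

Tm-isDistributiveLattice : IsDistributiveLattice _≈ₜ_ _∨ₜ_ _∧ₜ_
Tm-isDistributiveLattice = record
  { isLattice   = record
    { isEquivalence = Setoid.isEquivalence ≈ₜ-setoid
    ; ∨-comm = ∨-comm ; ∨-assoc = ∨-assoc ; ∨-cong = ∨-cong
    ; ∧-comm = ∧-comm ; ∧-assoc = ∧-assoc ; ∧-cong = ∧-cong
    ; absorptive = ∨-absorbs-∧ , ∧-absorbs-∨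
    }
  ; ∨-distrib-∧ = ∨ₜ-distrib-∧ₜ
  ; ∧-distrib-∨ = ∧ₜ-distrib-∨ₜ
  }

module L = BoundedDistributiveLatticeOrder Tm-isDistributiveLattice ∨-identity ∧-identity

gen-mono : ∀ {p q} → Star GenRel p q → gen p ≤ₜ gen q
gen-mono = Star.fold (λ p q → gen p ≤ₜ gen q) (λ r → L.≤-trans (rel r)) L.≤-refl

gens : List Gen
gens = x ∷ □x ∷ ◇x ∷ ◇□x ∷ □◇x ∷ □◇□x ∷ ◇□◇x ∷ []

∈-gens : ∀ g → g ∈ gens
∈-gens x    = here ≡.refl
∈-gens □x   = there (here ≡.refl)
∈-gens ◇x   = there (there (here ≡.refl))
∈-gens ◇□x  = there (there (there (here ≡.refl)))
∈-gens □◇x  = there (there (there (there (here ≡.refl))))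
∈-gens □◇□x = there (there (there (there (there (here ≡.refl)))))
∈-gens ◇□◇x = there (there (there (there (there (there (here ≡.refl))))))

∀-Gen? : ∀ {p} {P : Pred Gen p} → Decidable P → Dec (∀ g → P g)
∀-Gen? P? = map′ (λ all g → All.lookup all (∈-gens g)) (λ all → All.tabulate (λ {g} _ → all g))
                 (All.all? P? gens)

_≡ᵍ_ : Gen → Gen → Bool
x    ≡ᵍ x    = true
□x   ≡ᵍ □x   = true
◇x   ≡ᵍ ◇x   = true
◇□x  ≡ᵍ ◇□x  = true
□◇x  ≡ᵍ □◇x  = true
□◇□x ≡ᵍ □◇□x = true
◇□◇x ≡ᵍ ◇□◇x = true
_    ≡ᵍ _    = false

W : Set
W = Fin 14

-- The worlds are the fourteen up-sets of the generator poset (the prime filters of the presented lattice).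
upsets : Vec (List Gen) 14
upsets =
    []
  ∷ (◇x ∷ [])
  ∷ (◇x ∷ ◇□◇x ∷ [])
  ∷ (◇x ∷ □◇x ∷ ◇□◇x ∷ [])
  ∷ (◇x ∷ ◇□x ∷ ◇□◇x ∷ [])
  ∷ (◇x ∷ ◇□x ∷ □◇x ∷ ◇□◇x ∷ [])
  ∷ (◇x ∷ ◇□x ∷ □◇x ∷ □◇□x ∷ ◇□◇x ∷ [])
  ∷ (x ∷ ◇x ∷ [])
  ∷ (x ∷ ◇x ∷ ◇□◇x ∷ [])
  ∷ (x ∷ ◇x ∷ □◇x ∷ ◇□◇x ∷ [])
  ∷ (x ∷ ◇x ∷ ◇□x ∷ ◇□◇x ∷ [])
  ∷ (x ∷ ◇x ∷ ◇□x ∷ □◇x ∷ ◇□◇x ∷ [])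
  ∷ (x ∷ ◇x ∷ ◇□x ∷ □◇x ∷ □◇□x ∷ ◇□◇x ∷ [])
  ∷ gens
  ∷ []

val : W → Gen → Bool
val w g = any (g ≡ᵍ_) (lookup upsets w)

-- Opaque: filtering this concrete list by an undetermined predicate would unfold to an
-- exponentially large term.
opaque
  worlds : List W
  worlds = allFin 14

  ∈-worlds : ∀ w → w ∈ worlds
  ∈-worlds = ∈-allFin

infix 4 _⊨_ _⊨?_ _⊑_

_⊨_ : W → Tm → Set
w ⊨ gen p  = T (val w p)
w ⊨ ⊥ₜ     = ⊥
w ⊨ ⊤ₜ     = ⊤
w ⊨ s ∧ₜ t = w ⊨ s × w ⊨ t
w ⊨ s ∨ₜ t = w ⊨ s ⊎ w ⊨ t

_⊨?_ : ∀ w t → Dec (w ⊨ t)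
w ⊨? gen p  = T? (val w p)
w ⊨? ⊥ₜ     = no λ ()
w ⊨? ⊤ₜ     = yes tt
w ⊨? s ∧ₜ t = w ⊨? s ×-dec w ⊨? t
w ⊨? s ∨ₜ t = w ⊨? s ⊎-dec w ⊨? t

-- Facts about the finitely many worlds are established by evaluating a decision procedure
-- (from-yes); those stated opaque are never unfolded afterwards.
upward? : ∀ p q → Dec (∀ w → w ⊨ gen p → w ⊨ gen q)
upward? p q = all? (λ w → w ⊨? gen p →-dec w ⊨? gen q)

⊨-GenRel : ∀ {p q} → GenRel p q → ∀ w → w ⊨ gen p → w ⊨ gen q
⊨-GenRel □x≤x     = from-yes (upward? □x x)
⊨-GenRel x≤◇x     = from-yes (upward? x ◇x)
⊨-GenRel □x≤□◇□x  = from-yes (upward? □x □◇□x)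
⊨-GenRel □◇□x≤□◇x = from-yes (upward? □◇□x □◇x)
⊨-GenRel □◇x≤◇□◇x = from-yes (upward? □◇x ◇□◇x)
⊨-GenRel ◇□◇x≤◇x  = from-yes (upward? ◇□◇x ◇x)
⊨-GenRel □◇□x≤◇□x = from-yes (upward? □◇□x ◇□x)
⊨-GenRel ◇□x≤◇□◇x = from-yes (upward? ◇□x ◇□◇x)

⊨-cong : ∀ {s t} → s ≈ₜ t → ∀ {w} → w ⊨ s ⇔ w ⊨ t
⊨-cong refl                = ⇔.refl
⊨-cong (sym e)             = ⇔.sym (⊨-cong e)
⊨-cong (trans e f)         = ⇔.trans (⊨-cong e) (⊨-cong f)
⊨-cong (∧-cong e f)        = mk⇔ (Product.map (to (⊨-cong e)) (to (⊨-cong f)))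
                                 (Product.map (from (⊨-cong e)) (from (⊨-cong f)))
⊨-cong (∨-cong e f)        = mk⇔ (Sum.map (to (⊨-cong e)) (to (⊨-cong f)))
                                 (Sum.map (from (⊨-cong e)) (from (⊨-cong f)))
⊨-cong (∧-comm _ _)        = mk⇔ Product.swap Product.swap
⊨-cong (∨-comm _ _)        = mk⇔ Sum.swap Sum.swap
⊨-cong (∧-assoc _ _ _)     = mk⇔ Product.assocʳ′ Product.assocˡ′
⊨-cong (∨-assoc _ _ _)     = mk⇔ Sum.assocʳ Sum.assocˡ
⊨-cong (∧-absorbs-∨ _ _)   = mk⇔ proj₁ (λ ws → ws , inj₁ ws)
⊨-cong (∨-absorbs-∧ _ _)   = mk⇔ [ id , proj₁ ] inj₁
⊨-cong (∧-distrib-∨ _ _ _) = mk⇔ (λ (ws , wt∨u) → Sum.map (ws ,_) (ws ,_) wt∨u)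
                                 [ Product.map₂ inj₁ , Product.map₂ inj₂ ]
⊨-cong (∧-identity _)      = mk⇔ proj₁ (_, tt)
⊨-cong (∨-identity _)      = mk⇔ [ id , (λ ()) ] inj₁
⊨-cong (rel r) {w}         = mk⇔ proj₁ (λ wp → wp , ⊨-GenRel r w wp)

⊨-mono : ∀ {s t} w → s ≤ₜ t → w ⊨ s → w ⊨ t
⊨-mono _ s≤t ws = proj₂ (from (⊨-cong s≤t) ws)

_⊑_ : W → W → Set
w ⊑ u = ∀ g → w ⊨ gen g → u ⊨ gen g

_⊑?_ : ∀ w u → Dec (w ⊑ u)
w ⊑? u = ∀-Gen? (λ g → w ⊨? gen g →-dec u ⊨? gen g)

⊨-⊑ : ∀ {w u} t → w ⊑ u → w ⊨ t → u ⊨ t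
⊨-⊑ (gen p)  w⊑u = w⊑u p
⊨-⊑ ⊤ₜ       w⊑u = id
⊨-⊑ (s ∧ₜ t) w⊑u = Product.map (⊨-⊑ s w⊑u) (⊨-⊑ t w⊑u)
⊨-⊑ (s ∨ₜ t) w⊑u = Sum.map (⊨-⊑ s w⊑u) (⊨-⊑ t w⊑u)

opaque
  join-exists : ∀ w w′ → ∃[ u ] (w ⊑ u × w′ ⊑ u × (∀ g → u ⊨ gen g → w ⊨ gen g ⊎ w′ ⊨ gen g))
  join-exists = from-yes (all? λ w → all? λ w′ → any? λ u →
    w ⊑? u ×-dec w′ ⊑? u ×-dec ∀-Gen? (λ g → u ⊨? gen g →-dec (w ⊨? gen g ⊎-dec w′ ⊨? gen g)))

-- Normal forms and completeness

minterm : W → Tm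
minterm w = L.⋀ (map gen (filter (λ g → w ⊨? gen g) gens))

minterm-≤ : ∀ w {g} → w ⊨ gen g → minterm w ≤ₜ gen g
minterm-≤ w {g} wg = L.⋀-lower (∈-map∘filter⁺ gen (λ g → w ⊨? gen g) (g , ∈-gens g , ≡.refl , wg))

≤-minterm : ∀ w {u} → (∀ g → w ⊨ gen g → u ≤ₜ gen g) → u ≤ₜ minterm w
≤-minterm w {u} u≤w = L.⋀-greatest (All.tabulate below)
  where
  below : ∀ {t} → t ∈ map gen (filter (λ g → w ⊨? gen g) gens) → u ≤ₜ t
  below t∈ with ∈-map∘filter⁻ gen (λ g → w ⊨? gen g) {xs = gens} t∈
  ... | g , _ , ≡.refl , wg = u≤w g wg

minterm-≤-⊨ : ∀ w t → w ⊨ t → minterm w ≤ₜ t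
minterm-≤-⊨ w (gen p)  wp        = minterm-≤ w wp
minterm-≤-⊨ w ⊤ₜ       _         = L.⊤-maximum _
minterm-≤-⊨ w (s ∧ₜ t) (ws , wt) = L.∧-greatest (minterm-≤-⊨ w s ws) (minterm-≤-⊨ w t wt)
minterm-≤-⊨ w (s ∨ₜ t) (inj₁ ws) = L.≤-trans (minterm-≤-⊨ w s ws) (L.x≤x∨y s t)
minterm-≤-⊨ w (s ∨ₜ t) (inj₂ wt) = L.≤-trans (minterm-≤-⊨ w t wt) (L.y≤x∨y s t)

minterm-∧ : ∀ w w′ u → (∀ g → u ⊨ gen g → w ⊨ gen g ⊎ w′ ⊨ gen g) →
            (minterm w ∧ₜ minterm w′) ≤ₜ minterm u
minterm-∧ w w′ u u⊆w∪w′ = ≤-minterm u λ g ug →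
  [ (λ wg  → L.≤-trans (L.x∧y≤x _ _) (minterm-≤ w wg))
  , (λ w′g → L.≤-trans (L.x∧y≤y _ _) (minterm-≤ w′ w′g)) ] (u⊆w∪w′ g ug)

principal : Gen → W
principal x    = # 7
principal □x   = # 13
principal ◇x   = # 1
principal ◇□x  = # 4
principal □◇x  = # 3
principal □◇□x = # 6
principal ◇□◇x = # 2

principal-⊨ : ∀ p → principal p ⊨ gen p
principal-⊨ = from-yes (∀-Gen? λ p → principal p ⊨? gen p)

principal-least : ∀ p → All (Star GenRel p) (filter (λ g → principal p ⊨? gen g) gens)
principal-least x    = ε ∷ (x≤◇x ◅ ε) ∷ []
principal-least □x   = (□x≤x ◅ ε) ∷ ε ∷ (□x≤x ◅ x≤◇x ◅ ε) ∷ (□x≤□◇□x ◅ □◇□x≤◇□x ◅ ε)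
                     ∷ (□x≤□◇□x ◅ □◇□x≤□◇x ◅ ε) ∷ (□x≤□◇□x ◅ ε)
                     ∷ (□x≤□◇□x ◅ □◇□x≤□◇x ◅ □◇x≤◇□◇x ◅ ε) ∷ []
principal-least ◇x   = ε ∷ []
principal-least ◇□x  = (◇□x≤◇□◇x ◅ ◇□◇x≤◇x ◅ ε) ∷ ε ∷ (◇□x≤◇□◇x ◅ ε) ∷ []
principal-least □◇x  = (□◇x≤◇□◇x ◅ ◇□◇x≤◇x ◅ ε) ∷ ε ∷ (□◇x≤◇□◇x ◅ ε) ∷ []
principal-least □◇□x = (□◇□x≤□◇x ◅ □◇x≤◇□◇x ◅ ◇□◇x≤◇x ◅ ε) ∷ (□◇□x≤◇□x ◅ ε) ∷ (□◇□x≤□◇x ◅ ε)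
                     ∷ ε ∷ (□◇□x≤□◇x ◅ □◇x≤◇□◇x ◅ ε) ∷ []
principal-least ◇□◇x = (◇□◇x≤◇x ◅ ε) ∷ ε ∷ []

gen≤minterm-principal : ∀ p → gen p ≤ₜ minterm (principal p)
gen≤minterm-principal p = L.⋀-greatest (All.map⁺ (All.map gen-mono (principal-least p)))

models countermodels : Tm → List W
models t        = filter (_⊨? t) worlds
countermodels t = filter (λ w → ¬? (w ⊨? t)) worlds

dnf : Tm → Tm
dnf t = L.⋁ (map minterm (models t))

minterm-≤-dnf : ∀ w t → w ⊨ t → minterm w ≤ₜ dnf t
minterm-≤-dnf w t wt = L.⋁-upper (∈-map∘filter⁺ minterm (_⊨? t) (w , ∈-worlds w , ≡.refl , wt))

dnf-least : ∀ t {u} → (∀ w → w ⊨ t → minterm w ≤ₜ u) → dnf t ≤ₜ u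
dnf-least t {u} t≤u = L.⋁-least (All.tabulate below)
  where
  below : ∀ {m} → m ∈ map minterm (models t) → m ≤ₜ u
  below m∈ with ∈-map∘filter⁻ minterm (_⊨? t) {xs = worlds} m∈
  ... | w , _ , ≡.refl , wt = t≤u w wt

dnf-∧ : ∀ s t → (dnf s ∧ₜ dnf t) ≤ₜ dnf (s ∧ₜ t)
dnf-∧ s t = L.⋁-∧-⋁-least _ _ below
  where
  below : ∀ {m m′} → m ∈ map minterm (models s) → m′ ∈ map minterm (models t) →
          (m ∧ₜ m′) ≤ₜ dnf (s ∧ₜ t)
  below m∈ m′∈ with ∈-map∘filter⁻ minterm (_⊨? s) {xs = worlds} m∈ | ∈-map∘filter⁻ minterm (_⊨? t) {xs = worlds} m′∈
  ... | w , _ , ≡.refl , ws | w′ , _ , ≡.refl , w′t with join-exists w w′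
  ...   | u , w⊑u , w′⊑u , u⊆w∪w′ =
    L.≤-trans (minterm-∧ w w′ u u⊆w∪w′) (minterm-≤-dnf u (s ∧ₜ t) (⊨-⊑ s w⊑u ws , ⊨-⊑ t w′⊑u w′t))

≤-dnf : ∀ t → t ≤ₜ dnf t
≤-dnf (gen p)  = L.≤-trans (gen≤minterm-principal p) (minterm-≤-dnf (principal p) (gen p) (principal-⊨ p))
≤-dnf ⊥ₜ       = L.⊥-minimum _
≤-dnf ⊤ₜ       = minterm-≤-dnf (# 0) ⊤ₜ tt
≤-dnf (s ∧ₜ t) = L.≤-trans (L.∧-monotonic (≤-dnf s) (≤-dnf t)) (dnf-∧ s t)
≤-dnf (s ∨ₜ t) = L.∨-least (L.≤-trans (≤-dnf s) (dnf-least s λ w ws → minterm-≤-dnf w (s ∨ₜ t) (inj₁ ws)))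
                           (L.≤-trans (≤-dnf t) (dnf-least t λ w wt → minterm-≤-dnf w (s ∨ₜ t) (inj₂ wt)))

≤-complete : ∀ {s t} → (∀ w → w ⊨ s → w ⊨ t) → s ≤ₜ t
≤-complete {s} {t} s⊨t = L.≤-trans (≤-dnf s) (dnf-least s λ w ws → minterm-≤-⊨ w t (s⊨t w ws))

≈-dnf : ∀ t → t ≈ₜ dnf t
≈-dnf t = L.≤-antisym (≤-dnf t) (dnf-least t λ w wt → minterm-≤-⊨ w t wt)

infix 4 _≤?_

_≤?_ : ∀ s t → Dec (s ≤ₜ t)
s ≤? t = map′ ≤-complete (λ s≤t w → ⊨-mono w s≤t) (all? λ w → w ⊨? s →-dec w ⊨? t)

≈-complete : ∀ {s t} → (∀ w → w ⊨ s → w ⊨ t) → (∀ w → w ⊨ t → w ⊨ s) → s ≈ₜ t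
≈-complete s⇒t t⇒s = L.≤-antisym (≤-complete s⇒t) (≤-complete t⇒s)

⊨-⋀⁺ : ∀ {w} ts → All (w ⊨_) ts → w ⊨ L.⋀ ts
⊨-⋀⁺ []       []         = tt
⊨-⋀⁺ (t ∷ ts) (wt ∷ wts) = wt , ⊨-⋀⁺ ts wts

⊨-⋁⁻ : ∀ {w} ts → w ⊨ L.⋁ ts → ∃[ t ] (t ∈ ts × w ⊨ t)
⊨-⋁⁻ (t ∷ ts) (inj₁ wt)  = t , here ≡.refl , wt
⊨-⋁⁻ (t ∷ ts) (inj₂ wts) = let u , u∈ts , wu = ⊨-⋁⁻ ts wts in u , there u∈ts , wu

maxterm : W → Tm
maxterm w = L.⋁ (map gen (filter (λ g → ¬? (w ⊨? gen g)) gens))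

gen≤maxterm : ∀ w {g} → ¬ (w ⊨ gen g) → gen g ≤ₜ maxterm w
gen≤maxterm w {g} ¬wg = L.⋁-upper (∈-map∘filter⁺ gen (λ g → ¬? (w ⊨? gen g)) (g , ∈-gens g , ≡.refl , ¬wg))

⊭-maxterm : ∀ w → ¬ (w ⊨ maxterm w)
⊭-maxterm w w⊨maxterm with ⊨-⋁⁻ _ w⊨maxterm
... | t , t∈ , wt with ∈-map∘filter⁻ gen (λ g → ¬? (w ⊨? gen g)) {xs = gens} t∈
...   | g , _ , ≡.refl , ¬wg = ¬wg wt

⊨-maxterm : ∀ {w w′} t → w ⊨ t → ¬ (w′ ⊨ t) → w ⊨ maxterm w′
⊨-maxterm {w} {w′} t wt ¬w′t = decidable-stable (w ⊨? maxterm w′) λ ¬w⊨maxterm →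
  ¬w′t (⊨-⊑ t (λ g wg → decidable-stable (w′ ⊨? gen g) λ ¬w′g →
                  ¬w⊨maxterm (⊨-mono w (gen≤maxterm w′ ¬w′g) wg)) wt)

cnf : Tm → Tm
cnf t = L.⋀ (map maxterm (countermodels t))

≈-cnf : ∀ t → t ≈ₜ cnf t
≈-cnf t = ≈-complete (λ w wt → ⊨-⋀⁺ _ (All.tabulate (⊨-maxterms wt))) ⊨-cnf⇒⊨
  where
  ⊨-maxterms : ∀ {w m} → w ⊨ t → m ∈ map maxterm (countermodels t) → w ⊨ m
  ⊨-maxterms wt m∈ with ∈-map∘filter⁻ maxterm (λ w → ¬? (w ⊨? t)) {xs = worlds} m∈
  ... | w′ , _ , ≡.refl , ¬w′t = ⊨-maxterm t wt ¬w′t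

  ⊨-cnf⇒⊨ : ∀ w → w ⊨ cnf t → w ⊨ t
  ⊨-cnf⇒⊨ w w⊨cnf = decidable-stable (w ⊨? t) λ ¬wt →
    ⊭-maxterm w (⊨-mono w (L.⋀-lower (∈-map∘filter⁺ maxterm (λ w → ¬? (w ⊨? t))
                                  (w , ∈-worlds w , ≡.refl , ¬wt))) w⊨cnf)

-- The modal operators

boxChain diaChain : List Tm
boxChain = ⊤ₜ ∷ gen □◇x ∷ gen □◇□x ∷ gen □x ∷ ⊥ₜ ∷ []
diaChain = ⊥ₜ ∷ gen ◇□x ∷ gen ◇□◇x ∷ gen ◇x ∷ ⊤ₜ ∷ []

opaque
  boxChain-descending : AllPairs (flip _≤ₜ_) boxChain
  boxChain-descending = from-yes (allPairs? (flip _≤?_) boxChain)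

  diaChain-ascending : AllPairs _≤ₜ_ diaChain
  diaChain-ascending = from-yes (allPairs? _≤?_ diaChain)

BoxChain⇒∈ : ∀ {d} → BoxChain d → d ∈ boxChain
BoxChain⇒∈ b4 = here ≡.refl
BoxChain⇒∈ b3 = there (here ≡.refl)
BoxChain⇒∈ b2 = there (there (here ≡.refl))
BoxChain⇒∈ b1 = there (there (there (here ≡.refl)))
BoxChain⇒∈ b0 = there (there (there (there (here ≡.refl))))

DiaChain⇒∈ : ∀ {d} → DiaChain d → d ∈ diaChain
DiaChain⇒∈ d0 = here ≡.refl
DiaChain⇒∈ d1 = there (here ≡.refl)
DiaChain⇒∈ d2 = there (there (here ≡.refl))
DiaChain⇒∈ d3 = there (there (there (here ≡.refl)))
DiaChain⇒∈ d4 = there (there (there (there (here ≡.refl))))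

opaque
  □ₜ ◇ₜ : Tm → Tm
  □ₜ t = first (_≤? t) ⊥ₜ boxChain
  ◇ₜ t = first (t ≤?_) ⊤ₜ diaChain

  □ₜ-All : ∀ {q} {Q : Pred Tm q} t → Q ⊥ₜ → All Q boxChain → Q (□ₜ t)
  □ₜ-All t = first-All (_≤? t) ⊥ₜ

  ◇ₜ-All : ∀ {q} {Q : Pred Tm q} t → Q ⊤ₜ → All Q diaChain → Q (◇ₜ t)
  ◇ₜ-All t = first-All (t ≤?_) ⊤ₜ

  □ₜ-≤ : ∀ t → □ₜ t ≤ₜ t
  □ₜ-≤ t = first-satisfies (_≤? t) ⊥ₜ (L.⊥-minimum t) boxChain

  ◇ₜ-≥ : ∀ t → t ≤ₜ ◇ₜ t
  ◇ₜ-≥ t = first-satisfies (t ≤?_) ⊤ₜ (L.⊤-maximum t) diaChain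

  □ₜ-greatest : ∀ {d t} → d ∈ boxChain → d ≤ₜ t → d ≤ₜ □ₜ t
  □ₜ-greatest {t = t} = first-greatest (_≤? t) ⊥ₜ L.≤-refl boxChain-descending

  ◇ₜ-least : ∀ {d t} → d ∈ diaChain → t ≤ₜ d → ◇ₜ t ≤ₜ d
  ◇ₜ-least {t = t} = first-greatest (t ≤?_) ⊤ₜ L.≤-refl diaChain-ascending

  □ₜ-x : gen □x ≈ₜ □ₜ (gen x)
  □ₜ-x = refl

  ◇ₜ-x : gen ◇x ≈ₜ ◇ₜ (gen x)
  ◇ₜ-x = refl

  ◇ₜ-□x : gen ◇□x ≈ₜ ◇ₜ (gen □x)
  ◇ₜ-□x = refl

  □ₜ-◇x : gen □◇x ≈ₜ □ₜ (gen ◇x)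
  □ₜ-◇x = refl

  □ₜ-◇□x : gen □◇□x ≈ₜ □ₜ (gen ◇□x)
  □ₜ-◇□x = refl

  ◇ₜ-□◇x : gen ◇□◇x ≈ₜ ◇ₜ (gen □◇x)
  ◇ₜ-□◇x = refl

□ₜ-∈ : ∀ t → □ₜ t ∈ boxChain
□ₜ-∈ t = □ₜ-All t (BoxChain⇒∈ b0) (All.tabulate id)

◇ₜ-∈ : ∀ t → ◇ₜ t ∈ diaChain
◇ₜ-∈ t = ◇ₜ-All t (DiaChain⇒∈ d4) (All.tabulate id)

□ₜ-largestBelow : ∀ t → IsLargestBelow BoxChain t (□ₜ t)
□ₜ-largestBelow t = (□ₜ t , □ₜ-All {Q = BoxChain} t b0 (b4 ∷ b3 ∷ b2 ∷ b1 ∷ b0 ∷ []) , refl)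
                  , □ₜ-≤ t , λ d d∈ d≤t → □ₜ-greatest (BoxChain⇒∈ d∈) d≤t

◇ₜ-smallestAbove : ∀ t → IsSmallestAbove DiaChain t (◇ₜ t)
◇ₜ-smallestAbove t = (◇ₜ t , ◇ₜ-All {Q = DiaChain} t d4 (d0 ∷ d1 ∷ d2 ∷ d3 ∷ d4 ∷ []) , refl)
                   , ◇ₜ-≥ t , λ d d∈ t≤d → ◇ₜ-least (DiaChain⇒∈ d∈) t≤d

□ₜ-mono : ∀ {s t} → s ≤ₜ t → □ₜ s ≤ₜ □ₜ t
□ₜ-mono {s} s≤t = □ₜ-greatest (□ₜ-∈ s) (L.≤-trans (□ₜ-≤ s) s≤t)

◇ₜ-mono : ∀ {s t} → s ≤ₜ t → ◇ₜ s ≤ₜ ◇ₜ t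
◇ₜ-mono {t = t} s≤t = ◇ₜ-least (◇ₜ-∈ t) (L.≤-trans s≤t (◇ₜ-≥ t))

R : W → W → Set
R w u = All (λ d → w ⊨ d → u ⊨ d) boxChain × All (λ d → u ⊨ d → w ⊨ d) diaChain

R? : ∀ w u → Dec (R w u)
R? w u = All.all? (λ d → w ⊨? d →-dec u ⊨? d) boxChain ×-dec All.all? (λ d → u ⊨? d →-dec w ⊨? d) diaChain

opaque
  box-witness : ∀ w → Any (λ k → w ⊨ k × (∀ w′ → w′ ⊨ k → ∃[ u ] (R w u × u ⊑ w′))) boxChain
  box-witness = from-yes (all? λ w → Any.any? (λ k →
    w ⊨? k ×-dec all? λ w′ → w′ ⊨? k →-dec any? λ u → R? w u ×-dec u ⊑? w′) boxChain)

  dia-witness : ∀ w → Any (λ l → ¬ (w ⊨ l) × (∀ w′ → ¬ (w′ ⊨ l) → ∃[ u ] (R w u × w′ ⊑ u))) diaChain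
  dia-witness = from-yes (all? λ w → Any.any? (λ l →
    ¬? (w ⊨? l) ×-dec all? λ w′ → ¬? (w′ ⊨? l) →-dec any? λ u → R? w u ×-dec w′ ⊑? u) diaChain)

⊨-□ₜ⁻ : ∀ {w u} t → w ⊨ □ₜ t → R w u → u ⊨ t
⊨-□ₜ⁻ {u = u} t w⊨□t (□wu , _) = ⊨-mono u (□ₜ-≤ t) (□ₜ-All t (λ ()) □wu w⊨□t)

⊨-□ₜ⁺ : ∀ {w} t → (∀ u → R w u → u ⊨ t) → w ⊨ □ₜ t
⊨-□ₜ⁺ {w} t R⇒t with find (box-witness w)
... | k , k∈ , wk , k⇒R = ⊨-mono w (□ₜ-greatest k∈ k≤t) wk
  where
  k≤t : k ≤ₜ t
  k≤t = ≤-complete λ w′ w′k → let u , wRu , u⊑w′ = k⇒R w′ w′k in ⊨-⊑ t u⊑w′ (R⇒t u wRu)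

⊨-◇ₜ⁺ : ∀ {w u} t → R w u → u ⊨ t → w ⊨ ◇ₜ t
⊨-◇ₜ⁺ {u = u} t (_ , ◇wu) ut = ◇ₜ-All t (λ _ → tt) ◇wu (⊨-mono u (◇ₜ-≥ t) ut)

⊨-◇ₜ⁻ : ∀ {w} t → w ⊨ ◇ₜ t → ∃[ u ] (R w u × u ⊨ t)
⊨-◇ₜ⁻ {w} t w⊨◇t = decidable-stable (any? λ u → R? w u ×-dec u ⊨? t) λ ∄u →
  let l , l∈ , ¬wl , ¬l⇒R = find (dia-witness w)
      t≤l = ≤-complete λ w′ w′t → decidable-stable (w′ ⊨? l) λ ¬w′l →
              let u , wRu , w′⊑u = ¬l⇒R w′ ¬w′l in ∄u (u , wRu , ⊨-⊑ t w′⊑u w′t)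
  in ¬wl (⊨-mono w (◇ₜ-least l∈ t≤l) w⊨◇t)

□ₜ-∧ : ∀ s t → □ₜ (s ∧ₜ t) ≈ₜ □ₜ s ∧ₜ □ₜ t
□ₜ-∧ s t = L.≤-antisym
  (L.∧-greatest (□ₜ-mono (L.x∧y≤x s t)) (□ₜ-mono (L.x∧y≤y s t)))
  (≤-complete λ w (w⊨□s , w⊨□t) → ⊨-□ₜ⁺ (s ∧ₜ t) λ u wRu → ⊨-□ₜ⁻ s w⊨□s wRu , ⊨-□ₜ⁻ t w⊨□t wRu)

◇ₜ-∨ : ∀ s t → ◇ₜ (s ∨ₜ t) ≈ₜ ◇ₜ s ∨ₜ ◇ₜ t
◇ₜ-∨ s t = L.≤-antisym
  (≤-complete λ w w⊨◇s∨t → let u , wRu , us∨t = ⊨-◇ₜ⁻ (s ∨ₜ t) w⊨◇s∨t in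
                             Sum.map (⊨-◇ₜ⁺ s wRu) (⊨-◇ₜ⁺ t wRu) us∨t)
  (L.∨-least (◇ₜ-mono (L.x≤x∨y s t)) (◇ₜ-mono (L.y≤x∨y s t)))

□ₜ∧◇ₜ≤◇ₜ∧ : ∀ s t → (□ₜ s ∧ₜ ◇ₜ t) ≤ₜ ◇ₜ (s ∧ₜ t)
□ₜ∧◇ₜ≤◇ₜ∧ s t = ≤-complete λ w (w⊨□s , w⊨◇t) →
  let u , wRu , ut = ⊨-◇ₜ⁻ t w⊨◇t in ⊨-◇ₜ⁺ (s ∧ₜ t) wRu (⊨-□ₜ⁻ s w⊨□s wRu , ut)

□ₜ∨≤□ₜ∨◇ₜ : ∀ s t → □ₜ (s ∨ₜ t) ≤ₜ (□ₜ s ∨ₜ ◇ₜ t)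
□ₜ∨≤□ₜ∨◇ₜ s t = ≤-complete λ w w⊨□s∨t → by-cases w w⊨□s∨t (any? λ u → R? w u ×-dec ¬? (u ⊨? s))
  where
  by-cases : ∀ w → w ⊨ □ₜ (s ∨ₜ t) → Dec (∃[ u ] (R w u × ¬ (u ⊨ s))) → w ⊨ □ₜ s ∨ₜ ◇ₜ t
  by-cases w w⊨□s∨t (yes (u , wRu , ¬us)) with ⊨-□ₜ⁻ (s ∨ₜ t) w⊨□s∨t wRu
  ... | inj₁ us = contradiction us ¬us
  ... | inj₂ ut = inj₂ (⊨-◇ₜ⁺ t wRu ut)
  by-cases w w⊨□s∨t (no ∄u) = inj₁ (⊨-□ₜ⁺ s λ u wRu → decidable-stable (u ⊨? s) λ ¬us → ∄u (u , wRu , ¬us))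

𝐀-isPositiveS4 : IsPositiveS4 _≈ₜ_ _∧ₜ_ _∨ₜ_ □ₜ ◇ₜ ⊥ₜ ⊤ₜ
𝐀-isPositiveS4 = record
  { isDistributiveLattice = Tm-isDistributiveLattice
  ; ∨-identityʳ = ∨-identity
  ; ∧-identityʳ = ∧-identity
  ; □-cong = λ s≈t → L.≤-antisym (□ₜ-mono (L.≤-reflexive s≈t)) (□ₜ-mono (L.≤-reflexive (sym s≈t)))
  ; ◇-cong = λ s≈t → L.≤-antisym (◇ₜ-mono (L.≤-reflexive s≈t)) (◇ₜ-mono (L.≤-reflexive (sym s≈t)))
  ; □-1 = L.≤-antisym (L.⊤-maximum _) (□ₜ-greatest (BoxChain⇒∈ b4) L.≤-refl)
  ; ◇-0 = L.≤-antisym (◇ₜ-least (DiaChain⇒∈ d0) L.≤-refl) (L.⊥-minimum _)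
  ; □-∧ = □ₜ-∧
  ; ◇-∨ = ◇ₜ-∨
  ; □∧◇≤◇∧ = □ₜ∧◇ₜ≤◇ₜ∧
  ; □∨≤□∨◇ = □ₜ∨≤□ₜ∨◇ₜ
  ; □□ = λ t → L.≤-antisym (□ₜ-≤ (□ₜ t)) (□ₜ-greatest (□ₜ-∈ t) L.≤-refl)
  ; □≤ = □ₜ-≤
  ; ≤◇ = ◇ₜ-≥
  ; ◇◇ = λ t → L.≤-antisym (◇ₜ-least (◇ₜ-∈ t) L.≤-refl) (◇ₜ-≥ (◇ₜ t))
  }

𝐀ₜ : PositiveS4 0ℓ 0ℓ
𝐀ₜ = 𝐀 □ₜ ◇ₜ 𝐀-isPositiveS4

module A = IsPositiveS4 𝐀-isPositiveS4

-- Freeness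

-- (y , z) ∈ □-bounds has z on the box chain and □y ≤ z in every positive S4-algebra;
-- dually (y , z) ∈ ◇-bounds has z on the diamond chain and z ≤ ◇y.
□-bounds ◇-bounds : List (Tm × Tm)
□-bounds = (⊥ₜ , ⊥ₜ) ∷ (gen x , gen □x) ∷ (gen ◇x , gen □◇x) ∷ (gen x ∨ₜ gen ◇□x , gen □◇□x) ∷ []
◇-bounds = (⊤ₜ , ⊤ₜ) ∷ (gen x , gen ◇x) ∷ (gen □x , gen ◇□x) ∷ (gen x ∧ₜ gen □◇x , gen ◇□◇x) ∷ []

□-bounds-chain : All (λ (_ , z) → z ∈ boxChain) □-bounds
□-bounds-chain = BoxChain⇒∈ b0 ∷ BoxChain⇒∈ b1 ∷ BoxChain⇒∈ b3 ∷ BoxChain⇒∈ b2 ∷ []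

◇-bounds-chain : All (λ (_ , z) → z ∈ diaChain) ◇-bounds
◇-bounds-chain = DiaChain⇒∈ d4 ∷ DiaChain⇒∈ d3 ∷ DiaChain⇒∈ d1 ∷ DiaChain⇒∈ d2 ∷ []

opaque
  maxterm-bounded : ∀ w → Any (λ (y , z) → maxterm w ≤ₜ y × z ≤ₜ maxterm w) □-bounds
  maxterm-bounded = from-yes (all? λ w → Any.any? (λ (y , z) → maxterm w ≤? y ×-dec z ≤? maxterm w) □-bounds)

  minterm-bounded : ∀ w → Any (λ (y , z) → y ≤ₜ minterm w × minterm w ≤ₜ z) ◇-bounds
  minterm-bounded = from-yes (all? λ w → Any.any? (λ (y , z) → y ≤? minterm w ×-dec minterm w ≤? z) ◇-bounds)

module Free {c ℓ} (B : PositiveS4 c ℓ) (b : PositiveS4.Carrier B) where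
  open PositiveS4 B hiding (_≤_)
  open PositiveS4Properties B
  module DL = IsDistributiveLattice isDistributiveLattice
  open ≤-Reasoning poset

  ι : Gen → Carrier
  ι x    = b
  ι □x   = □ b
  ι ◇x   = ◇ b
  ι ◇□x  = ◇ (□ b)
  ι □◇x  = □ (◇ b)
  ι □◇□x = □ (◇ (□ b))
  ι ◇□◇x = ◇ (□ (◇ b))

  ⟦_⟧ : Tm → Carrier
  ⟦ gen p  ⟧ = ι p
  ⟦ ⊥ₜ     ⟧ = 0#
  ⟦ ⊤ₜ     ⟧ = 1#
  ⟦ s ∧ₜ t ⟧ = ⟦ s ⟧ ∧ ⟦ t ⟧
  ⟦ s ∨ₜ t ⟧ = ⟦ s ⟧ ∨ ⟦ t ⟧

  ι-mono : ∀ {p q} → GenRel p q → ι p ≤ ι q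
  ι-mono □x≤x     = □≤ b
  ι-mono x≤◇x     = ≤◇ b
  ι-mono □x≤□◇□x  = ≤-trans (□≤□□ b) (□-mono (≤◇ (□ b)))
  ι-mono □◇□x≤□◇x = □-mono (◇-mono (□≤ b))
  ι-mono □◇x≤◇□◇x = ≤◇ (□ (◇ b))
  ι-mono ◇□◇x≤◇x  = ≤-trans (◇-mono (□≤ (◇ b))) (◇◇≤◇ b)
  ι-mono □◇□x≤◇□x = □≤ (◇ (□ b))
  ι-mono ◇□x≤◇□◇x = ◇-mono (□-mono (≤◇ b))

  ⟦⟧-cong : ∀ {s t} → s ≈ₜ t → ⟦ s ⟧ ≈ ⟦ t ⟧
  ⟦⟧-cong refl                = DL.refl
  ⟦⟧-cong (sym e)             = DL.sym (⟦⟧-cong e)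
  ⟦⟧-cong (trans e f)         = DL.trans (⟦⟧-cong e) (⟦⟧-cong f)
  ⟦⟧-cong (∧-cong e f)        = DL.∧-cong (⟦⟧-cong e) (⟦⟧-cong f)
  ⟦⟧-cong (∨-cong e f)        = DL.∨-cong (⟦⟧-cong e) (⟦⟧-cong f)
  ⟦⟧-cong (∧-comm s t)        = DL.∧-comm ⟦ s ⟧ ⟦ t ⟧
  ⟦⟧-cong (∨-comm s t)        = DL.∨-comm ⟦ s ⟧ ⟦ t ⟧
  ⟦⟧-cong (∧-assoc s t u)     = DL.∧-assoc ⟦ s ⟧ ⟦ t ⟧ ⟦ u ⟧
  ⟦⟧-cong (∨-assoc s t u)     = DL.∨-assoc ⟦ s ⟧ ⟦ t ⟧ ⟦ u ⟧
  ⟦⟧-cong (∧-absorbs-∨ s t)   = DL.∧-absorbs-∨ ⟦ s ⟧ ⟦ t ⟧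
  ⟦⟧-cong (∨-absorbs-∧ s t)   = DL.∨-absorbs-∧ ⟦ s ⟧ ⟦ t ⟧
  ⟦⟧-cong (∧-distrib-∨ s t u) = DL.∧-distribˡ-∨ ⟦ s ⟧ ⟦ t ⟧ ⟦ u ⟧
  ⟦⟧-cong (∧-identity s)      = ∧-identityʳ ⟦ s ⟧
  ⟦⟧-cong (∨-identity s)      = ∨-identityʳ ⟦ s ⟧
  ⟦⟧-cong (rel r)             = ι-mono r

  ⟦⟧-mono : ∀ {s t} → s ≤ₜ t → ⟦ s ⟧ ≤ ⟦ t ⟧
  ⟦⟧-mono = ⟦⟧-cong

  □-bounds-valid : All (λ (y , z) → □ ⟦ y ⟧ ≤ ⟦ z ⟧) □-bounds
  □-bounds-valid = □≤ 0# ∷ ≤-refl ∷ ≤-refl ∷ □[x∨◇□x]≤□◇□x b ∷ []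

  ◇-bounds-valid : All (λ (y , z) → ⟦ z ⟧ ≤ ◇ ⟦ y ⟧) ◇-bounds
  ◇-bounds-valid = ≤◇ 1# ∷ ≤-refl ∷ ≤-refl ∷ ◇□◇x≤◇[x∧□◇x] b ∷ []

  □⟦maxterm⟧ : ∀ w → □ ⟦ maxterm w ⟧ ≤ ⟦ □ₜ (maxterm w) ⟧
  □⟦maxterm⟧ w =
    let (□y≤z , z∈) , (maxterm≤y , z≤maxterm) =
          All.lookupAny (All.zip (□-bounds-valid , □-bounds-chain)) (maxterm-bounded w)
    in ≤-trans (□-mono (⟦⟧-mono maxterm≤y)) (≤-trans □y≤z (⟦⟧-mono (□ₜ-greatest z∈ z≤maxterm)))

  ◇⟦minterm⟧ : ∀ w → ⟦ ◇ₜ (minterm w) ⟧ ≤ ◇ ⟦ minterm w ⟧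
  ◇⟦minterm⟧ w =
    let (z≤◇y , z∈) , (y≤minterm , minterm≤z) =
          All.lookupAny (All.zip (◇-bounds-valid , ◇-bounds-chain)) (minterm-bounded w)
    in ≤-trans (⟦⟧-mono (◇ₜ-least z∈ minterm≤z)) (≤-trans z≤◇y (◇-mono (⟦⟧-mono y≤minterm)))

  □⟦⋀⟧ : ∀ ts → All (λ t → □ ⟦ t ⟧ ≤ ⟦ □ₜ t ⟧) ts → □ ⟦ L.⋀ ts ⟧ ≤ ⟦ □ₜ (L.⋀ ts) ⟧
  □⟦⋀⟧ []       []       = ≤-reflexive (DL.trans □-1 (⟦⟧-cong (sym A.□-1)))
  □⟦⋀⟧ (t ∷ ts) (□t≤ ∷ □ts≤) = begin
    □ (⟦ t ⟧ ∧ ⟦ L.⋀ ts ⟧)       ≈⟨ □-∧ _ _ ⟩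
    □ ⟦ t ⟧ ∧ □ ⟦ L.⋀ ts ⟧       ≤⟨ ∧-monotonic □t≤ (□⟦⋀⟧ ts □ts≤) ⟩
    ⟦ □ₜ t ⟧ ∧ ⟦ □ₜ (L.⋀ ts) ⟧   ≈⟨ ⟦⟧-cong (A.□-∧ t (L.⋀ ts)) ⟨
    ⟦ □ₜ (t ∧ₜ L.⋀ ts) ⟧         ∎

  ◇⟦⋁⟧ : ∀ ts → All (λ t → ⟦ ◇ₜ t ⟧ ≤ ◇ ⟦ t ⟧) ts → ⟦ ◇ₜ (L.⋁ ts) ⟧ ≤ ◇ ⟦ L.⋁ ts ⟧
  ◇⟦⋁⟧ []       []       = ≤-reflexive (DL.trans (⟦⟧-cong A.◇-0) (DL.sym ◇-0))
  ◇⟦⋁⟧ (t ∷ ts) (◇t≤ ∷ ◇ts≤) = begin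
    ⟦ ◇ₜ (t ∨ₜ L.⋁ ts) ⟧         ≈⟨ ⟦⟧-cong (A.◇-∨ t (L.⋁ ts)) ⟩
    ⟦ ◇ₜ t ⟧ ∨ ⟦ ◇ₜ (L.⋁ ts) ⟧   ≤⟨ ∨-monotonic ◇t≤ (◇⟦⋁⟧ ts ◇ts≤) ⟩
    ◇ ⟦ t ⟧ ∨ ◇ ⟦ L.⋁ ts ⟧       ≈⟨ ◇-∨ _ _ ⟨
    ◇ (⟦ t ⟧ ∨ ⟦ L.⋁ ts ⟧)       ∎

  ⟦□ₜ⟧ : ∀ t → ⟦ □ₜ t ⟧ ≈ □ ⟦ t ⟧
  ⟦□ₜ⟧ t = ≤-antisym
    (begin
      ⟦ □ₜ t ⟧      ≤⟨ □ₜ-All t (⊥-minimum _) chain-open ⟩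
      □ ⟦ □ₜ t ⟧    ≤⟨ □-mono (⟦⟧-mono (□ₜ-≤ t)) ⟩
      □ ⟦ t ⟧       ∎)
    (begin
      □ ⟦ t ⟧          ≈⟨ □-cong (⟦⟧-cong (≈-cnf t)) ⟩
      □ ⟦ cnf t ⟧      ≤⟨ □⟦⋀⟧ _ (All.map⁺ (All.universal □⟦maxterm⟧ (countermodels t))) ⟩
      ⟦ □ₜ (cnf t) ⟧   ≈⟨ ⟦⟧-cong (A.□-cong (≈-cnf t)) ⟨
      ⟦ □ₜ t ⟧         ∎)
    where
    chain-open : All (λ d → ⟦ d ⟧ ≤ □ ⟦ d ⟧) boxChain
    chain-open = ≤-reflexive (DL.sym □-1) ∷ □≤□□ (◇ b) ∷ □≤□□ (◇ (□ b)) ∷ □≤□□ b ∷ ⊥-minimum _ ∷ []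

  ⟦◇ₜ⟧ : ∀ t → ⟦ ◇ₜ t ⟧ ≈ ◇ ⟦ t ⟧
  ⟦◇ₜ⟧ t = ≤-antisym
    (begin
      ⟦ ◇ₜ t ⟧         ≈⟨ ⟦⟧-cong (A.◇-cong (≈-dnf t)) ⟩
      ⟦ ◇ₜ (dnf t) ⟧   ≤⟨ ◇⟦⋁⟧ _ (All.map⁺ (All.universal ◇⟦minterm⟧ (models t))) ⟩
      ◇ ⟦ dnf t ⟧      ≈⟨ ◇-cong (⟦⟧-cong (≈-dnf t)) ⟨
      ◇ ⟦ t ⟧          ∎)
    (begin
      ◇ ⟦ t ⟧          ≤⟨ ◇-mono (⟦⟧-mono (◇ₜ-≥ t)) ⟩
      ◇ ⟦ ◇ₜ t ⟧       ≤⟨ ◇ₜ-All t (⊤-maximum _) chain-closed ⟩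
      ⟦ ◇ₜ t ⟧         ∎)
    where
    chain-closed : All (λ d → ◇ ⟦ d ⟧ ≤ ⟦ d ⟧) diaChain
    chain-closed = ≤-reflexive ◇-0 ∷ ◇◇≤◇ (□ b) ∷ ◇◇≤◇ (□ (◇ b)) ∷ ◇◇≤◇ b ∷ ⊤-maximum _ ∷ []

  ⟦⟧-isHom : IsHom 𝐀ₜ B ⟦_⟧
  ⟦⟧-isHom = record
    { cong  = ⟦⟧-cong
    ; hom-∧ = λ _ _ → DL.refl
    ; hom-∨ = λ _ _ → DL.refl
    ; hom-□ = ⟦□ₜ⟧
    ; hom-◇ = ⟦◇ₜ⟧
    ; hom-0 = DL.refl
    ; hom-1 = DL.refl
    }

  ⟦⟧-unique : ∀ {f} → IsHom 𝐀ₜ B f → f (gen x) ≈ b → ∀ t → ⟦ t ⟧ ≈ f t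
  ⟦⟧-unique {f} f-hom f[x]≈b = agree
    where
    module H = IsHom f-hom

    via□ : ∀ {p q} → gen p ≈ₜ □ₜ (gen q) → ι q ≈ f (gen q) → □ (ι q) ≈ f (gen p)
    via□ {q = q} p≈□q e = DL.trans (□-cong e) (DL.sym (DL.trans (H.cong p≈□q) (H.hom-□ (gen q))))

    via◇ : ∀ {p q} → gen p ≈ₜ ◇ₜ (gen q) → ι q ≈ f (gen q) → ◇ (ι q) ≈ f (gen p)
    via◇ {q = q} p≈◇q e = DL.trans (◇-cong e) (DL.sym (DL.trans (H.cong p≈◇q) (H.hom-◇ (gen q))))

    ι-unique : ∀ p → ι p ≈ f (gen p)
    ι-unique x    = DL.sym f[x]≈b
    ι-unique □x   = via□ □ₜ-x (ι-unique x)
    ι-unique ◇x   = via◇ ◇ₜ-x (ι-unique x)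
    ι-unique ◇□x  = via◇ ◇ₜ-□x (via□ □ₜ-x (ι-unique x))
    ι-unique □◇x  = via□ □ₜ-◇x (via◇ ◇ₜ-x (ι-unique x))
    ι-unique □◇□x = via□ □ₜ-◇□x (via◇ ◇ₜ-□x (via□ □ₜ-x (ι-unique x)))
    ι-unique ◇□◇x = via◇ ◇ₜ-□◇x (via□ □ₜ-◇x (via◇ ◇ₜ-x (ι-unique x)))

    agree : ∀ t → ⟦ t ⟧ ≈ f t
    agree (gen p)  = ι-unique p
    agree ⊥ₜ       = DL.sym H.hom-0
    agree ⊤ₜ       = DL.sym H.hom-1
    agree (s ∧ₜ t) = DL.trans (DL.∧-cong (agree s) (agree t)) (DL.sym (H.hom-∧ s t))
    agree (s ∨ₜ t) = DL.trans (DL.∨-cong (agree s) (agree t)) (DL.sym (H.hom-∨ s t))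

𝐀ₜ-free : ∀ c ℓ → IsFreeOn 𝐀ₜ (gen x) c ℓ
𝐀ₜ-free c ℓ B b = ⟦_⟧ , ⟦⟧-isHom , DL.refl , λ f f-hom f[x]≈b → ⟦⟧-unique f-hom f[x]≈b
  where open Free B b

theorem5p1 : (c ℓ : Level) →
    Σ[ □ₜ ∈ (Tm → Tm) ] Σ[ ◇ₜ ∈ (Tm → Tm) ]
      ((∀ t → IsLargestBelow BoxChain t (□ₜ t)) ×
       (∀ t → IsSmallestAbove DiaChain t (◇ₜ t)) ×
       Σ[ isS4 ∈ IsPositiveS4 _≈ₜ_ _∧ₜ_ _∨ₜ_ □ₜ ◇ₜ ⊥ₜ ⊤ₜ ]
         IsFreeOn (𝐀 □ₜ ◇ₜ isS4) (gen x) c ℓ)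
theorem5p1 c ℓ = □ₜ , ◇ₜ , □ₜ-largestBelow , ◇ₜ-smallestAbove , 𝐀-isPositiveS4 , 𝐀ₜ-free c ℓ
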